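{- The parity vertex chromatic number is not monotone with respect to minors: there exist a graph $G$ and a minor $H$ of $G$ with $\chi_p(H) > \chi_p(G)$.
   Context: All graphs are finite, simple and undirected. A vertex colouring $c: V(G)\to\{1,\dots,k\}$ of a graph $G$ is a parity vertex colouring if every (non-empty, simple) path in $G$ contains some colour an odd number of times (counting occurrences on the vertices of the path). $\chi_p(G)$ is the minimum number of colours in a parity vertex colouring of $G$. -}

module Defs where

open import Data.Nat using (ℕ; _<_)
open import Data.Nat.Divisibility using (_∣_)
open import Data.Fin using (Fin; _≟_)
open import Data.List using (List; []; _∷_; filter; map; length)
open import Data.List.Relation.Unary.Linked using (Linked)
open import Data.List.Relation.Unary.All using (All)
open import Data.List.Relation.Unary.Unique.Propositional using (Unique)
open import Data.Maybe using (Maybe; just)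
open import Data.Product using (Σ; ∃; ∃-syntax; _×_)
open import Relation.Nullary using (¬_)
open import Relation.Binary.PropositionalEquality using (_≡_)

record Graph (n : ℕ) : Set₁ where
  field
    Adj    : Fin n → Fin n → Set
    sym    : ∀ {u v} → Adj u v → Adj v u
    irrefl : ∀ {u} → ¬ Adj u u
open Graph public

record Path {n : ℕ} (G : Graph n) : Set where
  constructor path
  field
    verts    : List (Fin n)
    nonempty : ¬ (verts ≡ [])
    linked   : Linked (Adj G) verts
    distinct : Unique verts
open Path public

Odd : ℕ → Set
Odd m = ¬ (2 ∣ m)

occurrences : {n k : ℕ} → (Fin n → Fin k) → Fin k → List (Fin n) → ℕ
occurrences c j xs = length (filter (_≟ j) (map c xs))

-- parity vertex colouring with (at most) k colours {1..k} (here Fin k)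
IsParityColouring : {n : ℕ} (G : Graph n) {k : ℕ} → (Fin n → Fin k) → Set
IsParityColouring G {k} c =
  (P : Path G) → ∃[ j ] Odd (occurrences c j (verts P))

HasParityColouring : {n : ℕ} → Graph n → ℕ → Set
HasParityColouring {n} G k = ∃[ c ] IsParityColouring G {k} c

ChiP≡ : {n : ℕ} → Graph n → ℕ → Set
ChiP≡ G k = HasParityColouring G k × (∀ m → m < k → ¬ HasParityColouring G m)

-- x and y are joined by a walk in G all of whose vertices satisfy S
-- (i.e. x and y lie in the same component of the induced subgraph G[S]).
data ConnectedIn {n : ℕ} (G : Graph n) (S : Fin n → Set) : Fin n → Fin n → Set where
  stay : ∀ {x} → S x → ConnectedIn G S x x
  step : ∀ {x y z} → S x → Adj G x y → ConnectedIn G S y z → ConnectedIn G S x z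

-- H (on Fin m) is a minor of G (on Fin n): branch-set model.
-- β x = just u means vertex x of G lies in the branch set of vertex u of H;
-- branch sets are disjoint automatically (β is a function), non-empty,
-- connected in G, and adjacent vertices of H have adjacent branch sets.
record Minor {m n : ℕ} (H : Graph m) (G : Graph n) : Set where
  field
    β         : Fin n → Maybe (Fin m)
    nonEmpty  : ∀ u → ∃[ x ] β x ≡ just u
    connected : ∀ u x y → β x ≡ just u → β y ≡ just u →
                ConnectedIn G (λ w → β w ≡ just u) x y
    edges     : ∀ u v → Adj H u v →
                ∃[ x ] ∃[ y ] (β x ≡ just u × β y ≡ just v × Adj G x y)

module Submission where

-- Let G be the tree on 0..10 with a centre 0 carrying the legs 0-1-4, 0-2-5, 0-3-6 and
-- with two further legs 4-7-9, 4-8-10 hanging at 4, and let H = G/01 be obtained by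
-- contracting the edge 01.  Then χ_p(G) = 3 < 4 = χ_p(H).

open import Defs hiding (sym)
open import Function using (_∘_)
open import Function.Definitions using (Injective)
open import Data.Nat as ℕ using (ℕ; zero; suc; _≤_; s≤s⁻¹)
open import Data.Nat.Properties using (n<1+n)
open import Data.Nat.Divisibility using (_∣_; _∣?_)
open import Data.Fin as Fin using (Fin; zero; suc; #_; toℕ; _≟_; inject≤)
open import Data.Fin.Properties using (all?; any?; inject≤-injective)
open import Data.List using (List; []; _∷_; _++_; [_]; head; concatMap; map; filter; length; allFin)
open import Data.List.Properties using (++-assoc)
open import Data.List.Reverse using (Reverse; []; _∶_∶ʳ_; reverseView)
open import Data.List.Relation.Unary.All as All using (All; []; _∷_)
open import Data.List.Relation.Unary.Any as Any using (Any; here)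
open import Data.List.Relation.Unary.AllPairs using ([]; _∷_)
open import Data.List.Relation.Unary.Linked as Linked using (Linked; [-]; _∷′_)
open import Data.List.Relation.Unary.Unique.Propositional using (Unique)
open import Data.List.Membership.Propositional using (_∈_)
import Data.List.Membership.DecPropositional as DecMembership
open import Data.Maybe using (Maybe; just; nothing; zipWith)
open import Data.Maybe.Properties using () renaming (≡-dec to ≡-decMaybe)
open import Data.Maybe.Relation.Binary.Connected using (Connected; connected?)
open import Data.Maybe.Relation.Unary.Any as MaybeAny using (just)
open import Data.Product using (Σ; ∃-syntax; _×_; _,_; proj₁; proj₂)
open import Data.Product.Properties using () renaming (≡-dec to ≡-decPair)
open import Data.Sum using (_⊎_; inj₁; inj₂; swap)
open import Data.Vec using (lookup) renaming ([] to []ᵥ; _∷_ to _∷ᵥ_)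
open import Data.Empty using (⊥; ⊥-elim)
open import Relation.Nullary using (¬_; Dec; yes; no)
open import Relation.Nullary.Decidable using (¬?; _×-dec_; _⊎-dec_; _→-dec_; from-yes)
open import Relation.Binary.PropositionalEquality using (_≡_; _≢_; refl; sym; cong; cong₂; subst)

occurrences-recolour : {n k k′ : ℕ} (f : Fin k → Fin k′) → Injective _≡_ _≡_ f →
                       (c : Fin n → Fin k) (j : Fin k) (xs : List (Fin n)) →
                       occurrences (f ∘ c) (f j) xs ≡ occurrences c j xs
occurrences-recolour f f-inj c j [] = refl
occurrences-recolour f f-inj c j (x ∷ xs) with c x ≟ j | f (c x) ≟ f j
... | yes _   | yes _   = cong suc (occurrences-recolour f f-inj c j xs)
... | yes c≡j | no f≢   = ⊥-elim (f≢ (cong f c≡j))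
... | no c≢j  | yes f≡  = ⊥-elim (c≢j (f-inj f≡))
... | no _    | no _    = occurrences-recolour f f-inj c j xs

recolour : {n k k′ : ℕ} {G : Graph n} (f : Fin k → Fin k′) → Injective _≡_ _≡_ f →
           {c : Fin n → Fin k} → IsParityColouring G c → IsParityColouring G (f ∘ c)
recolour f f-inj {c} parity P with parity P
... | j , odd = f j , subst Odd (sym (occurrences-recolour f f-inj c j (verts P))) odd

colourable-mono : {n m m′ : ℕ} {G : Graph n} → m ≤ m′ →
                  HasParityColouring G m → HasParityColouring G m′
colourable-mono m≤m′ (c , parity) =
  (λ v → inject≤ (c v) m≤m′) ,
  recolour (λ i → inject≤ i m≤m′) (inject≤-injective m≤m′ m≤m′ _ _) parity

chiP-exact : {n k : ℕ} {G : Graph n} →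
             HasParityColouring G (suc k) → ¬ HasParityColouring G k → ChiP≡ G (suc k)
chiP-exact upper lower =
  upper , λ m m<1+k colourable → lower (colourable-mono (s≤s⁻¹ m<1+k) colourable)

module PathSearch {n : ℕ} (G : Graph n) (adj? : (u v : Fin n) → Dec (Adj G u v)) where

  Simple : List (Fin n) → Set
  Simple ys = Linked (Adj G) ys × Unique ys

  Step : Fin n → List (Fin n) → Set
  Step w ys = Connected (Adj G) (just w) (head ys) × All (w ≢_) ys

  step? : (w : Fin n) (ys : List (Fin n)) → Dec (Step w ys)
  step? w ys = connected? adj? (just w) (head ys) ×-dec All.all? (λ y → ¬? (w ≟ y)) ys

  step-simple : {w : Fin n} {ys : List (Fin n)} → Step w ys → Simple ys → Simple (w ∷ ys)
  step-simple (adjacent , fresh) (linked , unique) = adjacent ∷′ linked , fresh ∷ unique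

  prefix-step : {w : Fin n} {ys : List (Fin n)} (xs : List (Fin n)) →
                Simple (xs ++ w ∷ ys) → Step w ys
  prefix-step []       (linked , fresh ∷ _)  = Linked.head′ linked , fresh
  prefix-step (x ∷ xs) (linked , _ ∷ unique) = prefix-step xs (Linked.tail linked , unique)

  -- Everywhere Q f ys: Q holds at ys and at every simple path obtained from ys by
  -- prepending vertices, where after f prepended vertices no further step is possible.
  Everywhere : (List (Fin n) → Set) → ℕ → List (Fin n) → Set
  Everywhere Q zero    ys = Q ys × (∀ w → ¬ Step w ys)
  Everywhere Q (suc f) ys = Q ys × (∀ w → Step w ys → Everywhere Q f (w ∷ ys))

  everywhere? : {Q : List (Fin n) → Set} → (∀ ys → Dec (Q ys)) →
                ∀ f ys → Dec (Everywhere Q f ys)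
  everywhere? Q? zero    ys = Q? ys ×-dec all? (λ w → ¬? (step? w ys))
  everywhere? Q? (suc f) ys = Q? ys ×-dec all? (λ w → step? w ys →-dec everywhere? Q? f (w ∷ ys))

  everywhere-here : {Q : List (Fin n) → Set} {ys : List (Fin n)} (f : ℕ) →
                    Everywhere Q f ys → Q ys
  everywhere-here zero    (holds , _) = holds
  everywhere-here (suc f) (holds , _) = holds

  -- The search reaches every simple path ending in ys.  The prefix xs is added one
  -- vertex at a time from its end, so it is traversed through its reverse view.
  everywhere-complete : {Q : List (Fin n) → Set} {f : ℕ} {ys xs : List (Fin n)} →
                        Everywhere Q f ys → Reverse xs → Simple (xs ++ ys) → Q (xs ++ ys)
  everywhere-complete {f = f} everywhere [] _ = everywhere-here f everywhere
  everywhere-complete {Q} {f} {ys} everywhere (xs ∶ view ∶ʳ w) simple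
    rewrite ++-assoc xs [ w ] ys = continue f everywhere
    where
    continue : ∀ f → Everywhere Q f ys → Q (xs ++ w ∷ ys)
    continue zero    (_ , stuck) = ⊥-elim (stuck w (prefix-step xs simple))
    continue (suc f) (_ , next)  = everywhere-complete (next w (prefix-step xs simple)) view simple

  -- Q holds on every path of G: search from each possible last vertex.  Since a simple
  -- path has at most n vertices, n further steps exhaust the search (which Everywhere checks).
  EveryPath : (List (Fin n) → Set) → Set
  EveryPath Q = ∀ v → Everywhere Q n [ v ]

  everyPath? : {Q : List (Fin n) → Set} → (∀ ys → Dec (Q ys)) → Dec (EveryPath Q)
  everyPath? Q? = all? (λ v → everywhere? Q? n [ v ])

  everyPath-sound : {Q : List (Fin n) → Set} → EveryPath Q → (P : Path G) → Q (verts P)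
  everyPath-sound {Q} everywhere (path xs nonempty linked unique) =
    fromLastVertex (reverseView xs) nonempty (linked , unique)
    where
    fromLastVertex : ∀ {xs} → Reverse xs → ¬ xs ≡ [] → Simple xs → Q xs
    fromLastVertex []                 nonempty _      = ⊥-elim (nonempty refl)
    fromLastVertex (xs ∶ view ∶ʳ v) _        simple = everywhere-complete (everywhere v) view simple

  prepend : (P : Path G) (w : Fin n) → Step w (verts P) → Path G
  prepend P w w-step = path (w ∷ verts P) (λ ()) (proj₁ extended) (proj₂ extended)
    where
    extended : Simple (w ∷ verts P)
    extended = step-simple w-step (linked P , distinct P)

  growPaths : ℕ → Path G → List (Path G)
  growPaths zero    P = [ P ]
  growPaths (suc f) P = P ∷ concatMap prependIfPossible (allFin n)
    where
    prependIfPossible : Fin n → List (Path G)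
    prependIfPossible w with step? w (verts P)
    ... | yes w-step = growPaths f (prepend P w w-step)
    ... | no _       = []

  -- The paths of G, each in both directions.  Only the fact that every entry is a path
  -- is used: a schedule built from this list is sound whatever it contains.
  allPaths : List (Path G)
  allPaths = concatMap (λ v → growPaths n (path [ v ] (λ ()) [-] ([] ∷ []))) (allFin n)

  -- A search schedule: the vertices in the order in which they get coloured, each paired
  -- with the paths to test as soon as it has received its colour.
  Schedule : Set
  Schedule = List (Fin n × List (Path G))

  -- Colour the vertices in increasing order and test each path once its largest vertex
  -- is coloured, i.e. exactly when it has become fully coloured.
  increasingSchedule : Schedule
  increasingSchedule = map (λ v → v , filter (largest? v ∘ verts) allPaths) (allFin n)
    where
    largest? : (v : Fin n) (xs : List (Fin n)) → Dec (All (Fin._≤ v) xs × Any (v ≡_) xs)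
    largest? v xs = All.all? (Fin._≤? v) xs ×-dec Any.any? (v ≟_) xs

  module _ {k : ℕ} where

    HasOddColour : (Fin n → Fin k) → List (Fin n) → Set
    HasOddColour c xs = ∃[ j ] Odd (occurrences c j xs)

    hasOddColour? : (c : Fin n → Fin k) (xs : List (Fin n)) → Dec (HasOddColour c xs)
    hasOddColour? c xs = any? (λ j → ¬? (2 ∣? occurrences c j xs))

    PartialColouring : Set
    PartialColouring = Fin n → Maybe (Fin k)

    _[_≔_] : PartialColouring → Fin n → Fin k → PartialColouring
    (σ [ v ≔ x ]) w with w ≟ v
    ... | yes _ = just x
    ... | no _  = σ w

    _Extends_ : (Fin n → Fin k) → PartialColouring → Set
    c Extends σ = ∀ v x → σ v ≡ just x → c v ≡ x

    extends-update : {c : Fin n → Fin k} {σ : PartialColouring} →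
                     c Extends σ → ∀ v → c Extends (σ [ v ≔ c v ])
    extends-update extends v w x σw≡x with w ≟ v | σw≡x
    ... | yes refl | refl  = refl
    ... | no _     | σw≡x′ = extends w x σw≡x′

    coloursOf : PartialColouring → List (Fin n) → Maybe (List (Fin k))
    coloursOf σ []       = just []
    coloursOf σ (x ∷ xs) = zipWith _∷_ (σ x) (coloursOf σ xs)

    coloursOf-extends : {c : Fin n → Fin k} {σ : PartialColouring} → c Extends σ →
                        ∀ xs {cs} → coloursOf σ xs ≡ just cs → map c xs ≡ cs
    coloursOf-extends extends []       refl = refl
    coloursOf-extends {σ = σ} extends (x ∷ xs) eq with σ x in σx | coloursOf σ xs in σxs
    coloursOf-extends extends (x ∷ xs) refl | just a | just as =
      cong₂ _∷_ (extends x a σx) (coloursOf-extends extends xs σxs)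

    AllEven : List (Fin k) → Set
    AllEven cs = ∀ j → 2 ∣ length (filter (_≟ j) cs)

    EvenUnder : PartialColouring → List (Fin n) → Set
    EvenUnder σ xs = MaybeAny.Any AllEven (coloursOf σ xs)

    evenUnder? : (σ : PartialColouring) (xs : List (Fin n)) → Dec (EvenUnder σ xs)
    evenUnder? σ xs =
      MaybeAny.dec (λ cs → all? (λ j → 2 ∣? length (filter (_≟ j) cs))) (coloursOf σ xs)

    evenUnder-extends : {c : Fin n → Fin k} {σ : PartialColouring} → c Extends σ →
                        ∀ xs → EvenUnder σ xs → ∀ j → 2 ∣ occurrences c j xs
    evenUnder-extends {σ = σ} extends xs even-σ j with coloursOf σ xs in σxs | even-σ
    ... | just cs | just even =
      subst (λ ds → 2 ∣ length (filter (_≟ j) ds))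
            (sym (coloursOf-extends extends xs σxs)) (even j)

    Refuted : Schedule → PartialColouring → Set
    Refuted []                   σ = ⊥
    Refuted ((v , tests) ∷ rest) σ =
      ∀ x → Any (EvenUnder (σ [ v ≔ x ]) ∘ verts) tests ⊎ Refuted rest (σ [ v ≔ x ])

    refuted? : ∀ schedule σ → Dec (Refuted schedule σ)
    refuted? []                   σ = no (λ ())
    refuted? ((v , tests) ∷ rest) σ =
      all? (λ x → Any.any? (evenUnder? (σ [ v ≔ x ]) ∘ verts) tests
                  ⊎-dec refuted? rest (σ [ v ≔ x ]))

    -- Follow the branch of a refutation that c takes: it ends in a path c colours evenly.
    refuted-sound : ∀ schedule {σ} {c : Fin n → Fin k} →
                    Refuted schedule σ → c Extends σ → ¬ IsParityColouring G c
    refuted-sound ((v , tests) ∷ rest) {c = c} refuted extends parity with refuted (c v)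
    ... | inj₂ refuted′ = refuted-sound rest refuted′ (extends-update extends v) parity
    ... | inj₁ even-path with Any.satisfied even-path
    ...   | P , even-σ with parity P
    ...     | j , odd = odd (evenUnder-extends (extends-update extends v) (verts P) even-σ j)

    refuted-uncolourable : (schedule : Schedule) → Refuted schedule (λ _ → nothing) →
                           ¬ HasParityColouring G k
    refuted-uncolourable schedule refuted (c , parity) =
      refuted-sound schedule refuted (λ _ _ ()) parity

branch-edges? : {m n : ℕ} (H : Graph m) (G : Graph n) →
                (∀ u v → Dec (Adj H u v)) → (∀ x y → Dec (Adj G x y)) →
                (β : Fin n → Maybe (Fin m)) →
                Dec (∀ u v → Adj H u v →
                       ∃[ x ] ∃[ y ] (β x ≡ just u × β y ≡ just v × Adj G x y))
branch-edges? H G adjH? adjG? β =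
  all? λ u → all? λ v → adjH? u v →-dec any? λ x → any? λ y →
    ≡-decMaybe _≟_ (β x) (just u) ×-dec (≡-decMaybe _≟_ (β y) (just v) ×-dec adjG? x y)

module EdgeList (n : ℕ) (E : List (ℕ × ℕ)) where

  Adjacent : Fin n → Fin n → Set
  Adjacent u v = u ≢ v × ((toℕ u , toℕ v) ∈ E ⊎ (toℕ v , toℕ u) ∈ E)

  adjacent? : (u v : Fin n) → Dec (Adjacent u v)
  adjacent? u v = ¬? (u ≟ v) ×-dec ((toℕ u , toℕ v) ∈? E ⊎-dec (toℕ v , toℕ u) ∈? E)
    where open DecMembership (≡-decPair ℕ._≟_ ℕ._≟_) using (_∈?_)

  graph : Graph n
  graph = record
    { Adj    = Adjacent
    ; sym    = λ (u≢v , uv∈E) → (λ v≡u → u≢v (sym v≡u)) , swap uv∈E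
    ; irrefl = λ (u≢u , _) → u≢u refl
    }

  open PathSearch graph adjacent? public

module 𝔾 = EdgeList 11 ((0 , 1) ∷ (0 , 2) ∷ (0 , 3) ∷ (1 , 4) ∷ (2 , 5) ∷
                        (3 , 6) ∷ (4 , 7) ∷ (4 , 8) ∷ (7 , 9) ∷ (8 , 10) ∷ [])

-- H = G/01, with vertex i+1 of G renamed to i: the branch vertex 3 is now next to the centre.
module ℍ = EdgeList 10 ((0 , 1) ∷ (0 , 2) ∷ (0 , 3) ∷ (1 , 4) ∷ (2 , 5) ∷
                        (3 , 6) ∷ (3 , 7) ∷ (6 , 8) ∷ (7 , 9) ∷ [])

chiP-G : ChiP≡ 𝔾.graph 3
chiP-G = chiP-exact (colouring , parity) no-2-colouring
  where
  colouring : Fin 11 → Fin 3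
  colouring = lookup (# 0 ∷ᵥ # 1 ∷ᵥ # 1 ∷ᵥ # 1 ∷ᵥ # 2 ∷ᵥ # 2 ∷ᵥ
                      # 2 ∷ᵥ # 1 ∷ᵥ # 1 ∷ᵥ # 0 ∷ᵥ # 0 ∷ᵥ []ᵥ)

  parity : IsParityColouring 𝔾.graph colouring
  parity = 𝔾.everyPath-sound (from-yes (𝔾.everyPath? (𝔾.hasOddColour? colouring)))

  no-2-colouring : ¬ HasParityColouring 𝔾.graph 2
  no-2-colouring = 𝔾.refuted-uncolourable 𝔾.increasingSchedule
                     (from-yes (𝔾.refuted? {2} 𝔾.increasingSchedule (λ _ → nothing)))

chiP-H : ChiP≡ ℍ.graph 4
chiP-H = chiP-exact (colouring , parity) no-3-colouring
  where
  colouring : Fin 10 → Fin 4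
  colouring = lookup (# 0 ∷ᵥ # 1 ∷ᵥ # 1 ∷ᵥ # 1 ∷ᵥ # 2 ∷ᵥ # 2 ∷ᵥ
                      # 2 ∷ᵥ # 2 ∷ᵥ # 3 ∷ᵥ # 3 ∷ᵥ []ᵥ)

  parity : IsParityColouring ℍ.graph colouring
  parity = ℍ.everyPath-sound (from-yes (ℍ.everyPath? (ℍ.hasOddColour? colouring)))

  no-3-colouring : ¬ HasParityColouring ℍ.graph 3
  no-3-colouring = ℍ.refuted-uncolourable ℍ.increasingSchedule
                     (from-yes (ℍ.refuted? {3} ℍ.increasingSchedule (λ _ → nothing)))

contract01 : Fin 11 → Maybe (Fin 10)
contract01 zero          = just zero
contract01 (suc zero)    = just zero
contract01 (suc (suc u)) = just (suc u)

contract01-onto : ∀ u → ∃[ x ] contract01 x ≡ just u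
contract01-onto zero    = zero , refl
contract01-onto (suc u) = suc (suc u) , refl

-- The only branch set with two vertices is spanned by the edge 01 of G.
contract01-connected : ∀ u x y → contract01 x ≡ just u → contract01 y ≡ just u →
                       ConnectedIn 𝔾.graph (λ w → contract01 w ≡ just u) x y
contract01-connected _ zero          zero          refl refl = stay refl
contract01-connected _ zero          (suc zero)    refl refl = step refl edge01 (stay refl)
  where
  edge01 : 𝔾.Adjacent zero (suc zero)
  edge01 = (λ ()) , inj₁ (here refl)
contract01-connected _ (suc zero)    zero          refl refl = step refl edge10 (stay refl)
  where
  edge10 : 𝔾.Adjacent (suc zero) zero
  edge10 = (λ ()) , inj₂ (here refl)
contract01-connected _ (suc zero)    (suc zero)    refl refl = stay refl
contract01-connected _ (suc (suc a)) (suc (suc a)) refl refl = stay refl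
contract01-connected _ zero          (suc (suc _)) refl ()
contract01-connected _ (suc zero)    (suc (suc _)) refl ()
contract01-connected _ (suc (suc _)) zero          refl ()
contract01-connected _ (suc (suc _)) (suc zero)    refl ()

H-minor-of-G : Minor ℍ.graph 𝔾.graph
H-minor-of-G = record
  { β         = contract01
  ; nonEmpty  = contract01-onto
  ; connected = contract01-connected
  ; edges     = from-yes (branch-edges? ℍ.graph 𝔾.graph ℍ.adjacent? 𝔾.adjacent? contract01)
  }

theorem5 : Σ ℕ λ n → Σ ℕ λ m → Σ (Graph n) λ G → Σ (Graph m) λ H →
    Minor H G × ∃[ a ] ∃[ b ] (ChiP≡ G a × ChiP≡ H b × b ℕ.> a)
theorem5 = 11 , 10 , 𝔾.graph , ℍ.graph , H-minor-of-G , 3 , 4 , chiP-G , chiP-H , n<1+n 3
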